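{- Let $n,k$ be positive integers with $n\geq 2k+1$. In the neighborhood geometry $\tilde{KG}(n,k)$ of the Kneser graph $KG(n,k)$, both the $0$-diameter and the $1$-diameter are equal to $2\left\lceil\frac{k}{n-2k}\right\rceil+1$.
   Context: The Kneser graph $KG(n,k)$ has as vertices the $k$-subsets of $\{1,\ldots,n\}$, two being adjacent iff disjoint. For a graph $G$ with vertex set $G_0$, its neighborhood geometry $\tilde G$ is the rank two incidence structure with element set $G_0\times\{0\}\cup G_0\times\{1\}$, where elements of $G_0\times\{i\}$ have type $i$, and $(p,0)$ is incident to $(q,1)$ iff $p$ and $q$ are adjacent in $G$ (no two distinct elements of the same type are incident). Its incidence graph is the bipartite graph on these elements whose edges are the incident pairs $\{(p,0),(q,1)\}$. The $i$-diameter ($i\in\{0,1\}$) is the maximum, over all elements $x$ of type $i$ and all elements $y$, of the distance from $x$ to $y$ in the incidence graph. -}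

module Defs where

open import Data.Nat using (ℕ; zero; suc; _+_; _≤_; _<_)
open import Data.Nat.DivMod using (_/_)
open import Data.Bool using (Bool; true; false)
open import Data.Fin.Subset using (Subset; _∩_; ∣_∣; Empty)
open import Data.Product using (Σ; _×_; _,_; ∃; proj₁; proj₂)
open import Relation.Binary.PropositionalEquality using (_≡_)
open import Relation.Nullary using (¬_)

-- Ceiling division ⌈ a / b ⌉ for b ≥ 1 (value at b = 0 is an irrelevant junk 0).
ceilDiv : ℕ → ℕ → ℕ
ceilDiv a zero    = 0
ceilDiv a (suc b) = (a + b) / suc b

KVertex : ℕ → ℕ → Set
KVertex n k = Σ (Subset n) (λ s → ∣ s ∣ ≡ k)

KAdj : ∀ {n k} → KVertex n k → KVertex n k → Set
KAdj p q = Empty (proj₁ p ∩ proj₁ q)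

-- Elements of the neighborhood geometry: (vertex, type); type 0 = false, type 1 = true.
Elem : ℕ → ℕ → Set
Elem n k = KVertex n k × Bool

typeOf : ∀ {n k} → Elem n k → Bool
typeOf = proj₂

data IncEdge {n k : ℕ} : Elem n k → Elem n k → Set where
  e01 : ∀ {p q} → KAdj p q → IncEdge (p , false) (q , true)
  e10 : ∀ {p q} → KAdj p q → IncEdge (q , true) (p , false)

data Walk {n k : ℕ} : Elem n k → Elem n k → ℕ → Set where
  stop : ∀ {x} → Walk x x 0
  step : ∀ {x y z m} → IncEdge x y → Walk y z m → Walk x z (suc m)

DistLe : ∀ {n k} → Elem n k → Elem n k → ℕ → Set
DistLe x y d = ∃ λ m → m ≤ d × Walk x y m

IDiameter : (n k : ℕ) → Bool → ℕ → Set
IDiameter n k i D =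
  ((x y : Elem n k) → typeOf x ≡ i → DistLe x y D)
  × (Σ (Elem n k) λ x → Σ (Elem n k) λ y →
       typeOf x ≡ i × Walk x y D × (∀ m → m < D → ¬ Walk x y m))

-- Write n = 2k + t with t ≥ 1.  Upper bound: if A and B are k-sets, the k + t points outside A
-- contain |A ∩ B| + t points outside B, so one can step from A to a k-set C disjoint from A that
-- avoids as much of B as possible, and then to a k-set A′ disjoint from C with
-- |A′ ∩ B| = min(k, |A ∩ B| + t).  Hence (A, i) and (B, i) are joined by a walk of length 2j
-- once |A ∩ B| + jt ≥ k, in particular for j = ⌈k/t⌉ = c, and a first step to any neighbour
-- gives walks of length 2c + 1 between elements of different types.
-- Lower bound: two k-sets disjoint from a common k-set Q lie in the k + t points outside Q, so two
-- steps of a walk change the overlap with a fixed k-set A by at most t.  A walk from (A, i) to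
-- (A, 1 - i) has odd length 2j + 1 and its second element is disjoint from A, so k ≤ jt, i.e. j ≥ c.
module Submission where

open import Defs
open import Data.Bool using (Bool; true; false; not)
open import Data.Bool.Properties using (not-involutive; not-¬)
open import Data.Empty using (⊥-elim)
open import Data.Fin using (zero)
open import Data.Fin.Subset using (Subset; _∩_; ∁; ∣_∣; Empty; _⊆_; ⊤; inside; outside)
open import Data.Fin.Subset.Properties
  using (∣p∩q∣≤∣p∣; ∣p∩q∣≤∣q∣; ∣∁p∣≡n∸∣p∣; ∣⊤∣≡n; ∣⊥∣≡0; ∩-comm; ∩-idem; ∩-identityˡ; ∩-identityʳ;
         ⊆-refl; out⊆; in⊆in; x∈p∩q⁻; x∈∁p⇒x∉p; drop-∷-Empty; Empty-unique)
open import Data.Nat using (ℕ; zero; suc; _+_; _*_; _∸_; _⊓_; _≤_; _<_; z≤n; s≤s; s≤s⁻¹)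
open import Data.Nat.Properties
open import Algebra.Properties.CommutativeSemigroup +-commutativeSemigroup using (xy∙z≈xz∙y)
open import Data.Nat.DivMod using (_%_; m≡m%n+[m/n]*n; m%n<n; m<n*o⇒m/o<n)
open import Data.Product using (Σ; ∃; _×_; _,_; proj₁)
open import Data.Sum using (_⊎_; inj₁; inj₂)
open import Data.Vec using ([]; _∷_; here)
open import Relation.Binary.PropositionalEquality
open import Relation.Nullary using (¬_)

-- 2 * j, defined so that a walk of length twice (suc j) can be matched two steps at a time.
twice : ℕ → ℕ
twice zero    = zero
twice (suc j) = suc (suc (twice j))

twice≡2* : ∀ j → twice j ≡ 2 * j
twice≡2* zero    = refl
twice≡2* (suc j) = trans (cong (λ m → suc (suc m)) (twice≡2* j)) (cong suc (sym (+-suc j (j + 0))))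

1+twice≡2*+1 : ∀ j → suc (twice j) ≡ 2 * j + 1
1+twice≡2*+1 j = trans (cong suc (twice≡2* j)) (+-comm 1 (2 * j))

parity : ∀ m → ∃ λ j → m ≡ twice j ⊎ m ≡ suc (twice j)
parity zero = 0 , inj₁ refl
parity (suc m) with parity m
... | j , inj₁ refl = j , inj₂ refl
... | j , inj₂ refl = suc j , inj₁ refl

m≤⌈m/n⌉*n : ∀ m n → m ≤ ceilDiv m (suc n) * suc n
m≤⌈m/n⌉*n m n = +-cancelʳ-≤ n m (q * suc n) (begin
  m + n                       ≡⟨ m≡m%n+[m/n]*n (m + n) (suc n) ⟩
  (m + n) % suc n + q * suc n ≤⟨ +-monoˡ-≤ (q * suc n) (s≤s⁻¹ (m%n<n (m + n) (suc n))) ⟩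
  n + q * suc n               ≡⟨ +-comm n (q * suc n) ⟩
  q * suc n + n               ∎)
  where
  open ≤-Reasoning
  q = ceilDiv m (suc n)

m≤o*n⇒⌈m/n⌉≤o : ∀ {m} n o → m ≤ o * suc n → ceilDiv m (suc n) ≤ o
m≤o*n⇒⌈m/n⌉≤o {m} n o m≤o*n = s≤s⁻¹ (m<n*o⇒m/o<n {m + n} {suc o} {suc n}
  (s≤s (≤-trans (+-monoˡ-≤ n m≤o*n) (≤-reflexive (+-comm (o * suc n) n)))))

m≤n+[o+p]⇒m≤m⊓[n+o]+p : ∀ {m n o p} → m ≤ n + (o + p) → m ≤ m ⊓ (n + o) + p
m≤n+[o+p]⇒m≤m⊓[n+o]+p {m} {n} {o} {p} m≤n+[o+p] =
  subst (m ≤_) (sym (+-distribʳ-⊓ p m (n + o)))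
    (⊓-glb (m≤m+n m p) (subst (m ≤_) (sym (+-assoc n o p)) m≤n+[o+p]))

private
  variable
    n k : ℕ

∣p∩q∣+∣p∩∁q∣≡∣p∣ : (p q : Subset n) → ∣ p ∩ q ∣ + ∣ p ∩ ∁ q ∣ ≡ ∣ p ∣
∣p∩q∣+∣p∩∁q∣≡∣p∣ []            []            = refl
∣p∩q∣+∣p∩∁q∣≡∣p∣ (inside ∷ p)  (inside ∷ q)  = cong suc (∣p∩q∣+∣p∩∁q∣≡∣p∣ p q)
∣p∩q∣+∣p∩∁q∣≡∣p∣ (inside ∷ p)  (outside ∷ q) = trans (+-suc _ _) (cong suc (∣p∩q∣+∣p∩∁q∣≡∣p∣ p q))
∣p∩q∣+∣p∩∁q∣≡∣p∣ (outside ∷ p) (_ ∷ q)       = ∣p∩q∣+∣p∩∁q∣≡∣p∣ p q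

∣p∩q∣+∣∁p∩q∣≡∣q∣ : (p q : Subset n) → ∣ p ∩ q ∣ + ∣ ∁ p ∩ q ∣ ≡ ∣ q ∣
∣p∩q∣+∣∁p∩q∣≡∣q∣ p q = begin
  ∣ p ∩ q ∣ + ∣ ∁ p ∩ q ∣ ≡⟨ cong₂ _+_ (cong ∣_∣ (∩-comm p q)) (cong ∣_∣ (∩-comm (∁ p) q)) ⟩
  ∣ q ∩ p ∣ + ∣ q ∩ ∁ p ∣ ≡⟨ ∣p∩q∣+∣p∩∁q∣≡∣p∣ q p ⟩
  ∣ q ∣                   ∎
  where open ≡-Reasoning

∣r∩p∣+∣r∩q∣+∣r∩∁p∩∁q∣≡∣r∣ : (p q r : Subset n) → Empty (p ∩ q) →
  ∣ r ∩ p ∣ + ∣ r ∩ q ∣ + ∣ r ∩ ∁ p ∩ ∁ q ∣ ≡ ∣ r ∣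
∣r∩p∣+∣r∩q∣+∣r∩∁p∩∁q∣≡∣r∣ []            []            []            _ = refl
∣r∩p∣+∣r∩q∣+∣r∩∁p∩∁q∣≡∣r∣ (inside ∷ p)  (inside ∷ q)  _             p∩q=∅ = ⊥-elim (p∩q=∅ (zero , here))
∣r∩p∣+∣r∩q∣+∣r∩∁p∩∁q∣≡∣r∣ (_ ∷ p)       (_ ∷ q)       (outside ∷ r) p∩q=∅ =
  ∣r∩p∣+∣r∩q∣+∣r∩∁p∩∁q∣≡∣r∣ p q r (drop-∷-Empty p∩q=∅)
∣r∩p∣+∣r∩q∣+∣r∩∁p∩∁q∣≡∣r∣ (inside ∷ p)  (outside ∷ q) (inside ∷ r)  p∩q=∅ =
  cong suc (∣r∩p∣+∣r∩q∣+∣r∩∁p∩∁q∣≡∣r∣ p q r (drop-∷-Empty p∩q=∅))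
∣r∩p∣+∣r∩q∣+∣r∩∁p∩∁q∣≡∣r∣ (outside ∷ p) (inside ∷ q)  (inside ∷ r)  p∩q=∅ =
  trans (cong (_+ ∣ r ∩ ∁ p ∩ ∁ q ∣) (+-suc ∣ r ∩ p ∣ ∣ r ∩ q ∣))
        (cong suc (∣r∩p∣+∣r∩q∣+∣r∩∁p∩∁q∣≡∣r∣ p q r (drop-∷-Empty p∩q=∅)))
∣r∩p∣+∣r∩q∣+∣r∩∁p∩∁q∣≡∣r∣ (outside ∷ p) (outside ∷ q) (inside ∷ r)  p∩q=∅ =
  trans (+-suc _ _) (cong suc (∣r∩p∣+∣r∩q∣+∣r∩∁p∩∁q∣≡∣r∣ p q r (drop-∷-Empty p∩q=∅)))

∣p∣+∣q∣+∣∁p∩∁q∣≡n : (p q : Subset n) → Empty (p ∩ q) → ∣ p ∣ + ∣ q ∣ + ∣ ∁ p ∩ ∁ q ∣ ≡ n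
∣p∣+∣q∣+∣∁p∩∁q∣≡n {n} p q p∩q=∅ = begin
  ∣ p ∣ + ∣ q ∣ + ∣ ∁ p ∩ ∁ q ∣             ≡⟨ sym (cong₂ _+_ (cong₂ _+_ (∣⊤∩r∣ p) (∣⊤∩r∣ q)) (∣⊤∩r∣ (∁ p ∩ ∁ q))) ⟩
  ∣ ⊤ ∩ p ∣ + ∣ ⊤ ∩ q ∣ + ∣ ⊤ ∩ ∁ p ∩ ∁ q ∣ ≡⟨ ∣r∩p∣+∣r∩q∣+∣r∩∁p∩∁q∣≡∣r∣ p q ⊤ p∩q=∅ ⟩
  ∣ ⊤ {n} ∣                                 ≡⟨ ∣⊤∣≡n n ⟩
  n                                         ∎
  where
  open ≡-Reasoning
  ∣⊤∩r∣ : ∀ r → ∣ ⊤ ∩ r ∣ ≡ ∣ r ∣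
  ∣⊤∩r∣ r = cong ∣_∣ (∩-identityˡ r)

∣p∣≤∣p∩q∣⇒∣q∣≤∣p∩q∣⇒p≡q : {p q : Subset n} → ∣ p ∣ ≤ ∣ p ∩ q ∣ → ∣ q ∣ ≤ ∣ p ∩ q ∣ → p ≡ q
∣p∣≤∣p∩q∣⇒∣q∣≤∣p∩q∣⇒p≡q {p = []}          {q = []}          _ _ = refl
∣p∣≤∣p∩q∣⇒∣q∣≤∣p∩q∣⇒p≡q {p = inside ∷ p}  {q = inside ∷ q}  (s≤s p≤) (s≤s q≤) =
  cong (inside ∷_) (∣p∣≤∣p∩q∣⇒∣q∣≤∣p∩q∣⇒p≡q p≤ q≤)
∣p∣≤∣p∩q∣⇒∣q∣≤∣p∩q∣⇒p≡q {p = outside ∷ p} {q = outside ∷ q} p≤ q≤ =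
  cong (outside ∷_) (∣p∣≤∣p∩q∣⇒∣q∣≤∣p∩q∣⇒p≡q p≤ q≤)
∣p∣≤∣p∩q∣⇒∣q∣≤∣p∩q∣⇒p≡q {p = inside ∷ p}  {q = outside ∷ q} p<  _ = ⊥-elim (<⇒≱ p< (∣p∩q∣≤∣p∣ p q))
∣p∣≤∣p∩q∣⇒∣q∣≤∣p∩q∣⇒p≡q {p = outside ∷ p} {q = inside ∷ q}  _ q< = ⊥-elim (<⇒≱ q< (∣p∩q∣≤∣q∣ p q))

q⊆∁p⇒Empty[p∩q] : {p q : Subset n} → q ⊆ ∁ p → Empty (p ∩ q)
q⊆∁p⇒Empty[p∩q] {p = p} {q} q⊆∁p (x , x∈p∩q) =
  let x∈p , x∈q = x∈p∩q⁻ p q x∈p∩q in x∈∁p⇒x∉p (q⊆∁p x∈q) x∈p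

Empty-∩-comm : {p q : Subset n} → Empty (p ∩ q) → Empty (q ∩ p)
Empty-∩-comm {p = p} {q} = subst Empty (∩-comm p q)

choose-⊆ : (u b : Subset n) {i o : ℕ} → i ≤ ∣ u ∩ b ∣ → o ≤ ∣ u ∩ ∁ b ∣ →
           Σ (Subset n) λ v → v ⊆ u × ∣ v ∩ b ∣ ≡ i × ∣ v ∩ ∁ b ∣ ≡ o
choose-⊆ []            []                          z≤n      z≤n      = [] , ⊆-refl , refl , refl
choose-⊆ (outside ∷ u) (_ ∷ b)                     i≤       o≤       =
  let v , v⊆u , ∣v∩b∣≡i , ∣v∩∁b∣≡o = choose-⊆ u b i≤ o≤
  in  outside ∷ v , out⊆ v⊆u , ∣v∩b∣≡i , ∣v∩∁b∣≡o
choose-⊆ (inside ∷ u)  (inside ∷ b)  {i = zero}    _        o≤       =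
  let v , v⊆u , ∣v∩b∣≡0 , ∣v∩∁b∣≡o = choose-⊆ u b z≤n o≤
  in  outside ∷ v , out⊆ v⊆u , ∣v∩b∣≡0 , ∣v∩∁b∣≡o
choose-⊆ (inside ∷ u)  (inside ∷ b)  {i = suc _}   (s≤s i≤) o≤       =
  let v , v⊆u , ∣v∩b∣≡i , ∣v∩∁b∣≡o = choose-⊆ u b i≤ o≤
  in  inside ∷ v , in⊆in v⊆u , cong suc ∣v∩b∣≡i , ∣v∩∁b∣≡o
choose-⊆ (inside ∷ u)  (outside ∷ b) {o = zero}    i≤       _        =
  let v , v⊆u , ∣v∩b∣≡i , ∣v∩∁b∣≡0 = choose-⊆ u b i≤ z≤n
  in  outside ∷ v , out⊆ v⊆u , ∣v∩b∣≡i , ∣v∩∁b∣≡0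
choose-⊆ (inside ∷ u)  (outside ∷ b) {o = suc _}   i≤       (s≤s o≤) =
  let v , v⊆u , ∣v∩b∣≡i , ∣v∩∁b∣≡o = choose-⊆ u b i≤ o≤
  in  inside ∷ v , in⊆in v⊆u , ∣v∩b∣≡i , cong suc ∣v∩∁b∣≡o

choose-⊆-ofSize : (u : Subset n) {m : ℕ} → m ≤ ∣ u ∣ → Σ (Subset n) λ v → v ⊆ u × ∣ v ∣ ≡ m
choose-⊆-ofSize u {m} m≤∣u∣ =
  let v , v⊆u , ∣v∩⊤∣≡m , _ = choose-⊆ u ⊤ (subst (m ≤_) (sym (cong ∣_∣ (∩-identityʳ u))) m≤∣u∣) z≤n
  in v , v⊆u , trans (sym (cong ∣_∣ (∩-identityʳ v))) ∣v∩⊤∣≡m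

kset : Elem n k → Subset n
kset x = proj₁ (proj₁ x)

KAdj-sym : {A B : KVertex n k} → KAdj A B → KAdj B A
KAdj-sym = Empty-∩-comm

KVertex-≡ : {A B : KVertex n k} → proj₁ A ≡ proj₁ B → A ≡ B
KVertex-≡ {A = A , ∣A∣≡k} {B = .A , ∣B∣≡k} refl = cong (A ,_) (≡-irrelevant ∣A∣≡k ∣B∣≡k)

incident : (i : Bool) {A C : KVertex n k} → KAdj A C → IncEdge (A , i) (C , not i)
incident false {A} {C} A~C = e01 {p = A} {q = C} A~C
incident true  {A} {C} A~C = e10 {p = C} {q = A} (KAdj-sym {A = A} {B = C} A~C)

incident⇒KAdj : {x y : Elem n k} → IncEdge x y → KAdj (proj₁ x) (proj₁ y)
incident⇒KAdj (e01 p~q) = p~q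
incident⇒KAdj (e10 {p} {q} p~q) = KAdj-sym {A = p} {B = q} p~q

incident-flips-type : {x y : Elem n k} → IncEdge x y → typeOf y ≡ not (typeOf x)
incident-flips-type (e01 _) = refl
incident-flips-type (e10 _) = refl

twice-walk-preserves-type : {x y : Elem n k} (j : ℕ) → Walk x y (twice j) → typeOf y ≡ typeOf x
twice-walk-preserves-type zero    stop                  = refl
twice-walk-preserves-type {x = x} {y} (suc j) (step {y = x₁} e₁ (step {y = x₂} e₂ w)) = begin
  typeOf y              ≡⟨ twice-walk-preserves-type j w ⟩
  typeOf x₂             ≡⟨ incident-flips-type e₂ ⟩
  not (typeOf x₁)       ≡⟨ cong not (incident-flips-type e₁) ⟩
  not (not (typeOf x))  ≡⟨ not-involutive (typeOf x) ⟩
  typeOf x              ∎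
  where open ≡-Reasoning

detour : (i : Bool) {A C A′ B : KVertex n k} {m : ℕ} → KAdj A C → KAdj C A′ →
         Walk (A′ , i) (B , i) m → Walk (A , i) (B , i) (suc (suc m))
detour false {A} {C} {A′} A~C C~A′ w =
  step (incident false {A} {C} A~C) (step (incident true {C} {A′} C~A′) w)
detour true  {A} {C} {A′} A~C C~A′ w =
  step (incident true {A} {C} A~C) (step (incident false {C} {A′} C~A′) w)

-- The graph KG(2k + t, k) with t = 1 + t′, so that ceilDiv k t reduces to a division.
module KneserGeometry (k t′ : ℕ) where

  t : ℕ
  t = suc t′

  N : ℕ
  N = 2 * k + t

  c : ℕ
  c = ceilDiv k t

  V : Set
  V = KVertex N k

  N≡k+[k+t] : N ≡ k + (k + t)
  N≡k+[k+t] = trans (cong (λ m → k + m + t) (+-identityʳ k)) (+-assoc k k t)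

  ∣∁A∣≡k+t : (A : V) → ∣ ∁ (proj₁ A) ∣ ≡ k + t
  ∣∁A∣≡k+t (A , ∣A∣≡k) = begin
    ∣ ∁ A ∣             ≡⟨ ∣∁p∣≡n∸∣p∣ A ⟩
    N ∸ ∣ A ∣           ≡⟨ cong₂ _∸_ N≡k+[k+t] ∣A∣≡k ⟩
    k + (k + t) ∸ k     ≡⟨ m+n∸m≡n k (k + t) ⟩
    k + t               ∎
    where open ≡-Reasoning

  ∣∁A∩∁B∣≡t : (A B : V) → KAdj A B → ∣ ∁ (proj₁ A) ∩ ∁ (proj₁ B) ∣ ≡ t
  ∣∁A∩∁B∣≡t (A , ∣A∣≡k) (B , ∣B∣≡k) A~B = +-cancelˡ-≡ (k + k) _ t (begin
    k + k + ∣ ∁ A ∩ ∁ B ∣         ≡⟨ cong₂ (λ a b → a + b + ∣ ∁ A ∩ ∁ B ∣) (sym ∣A∣≡k) (sym ∣B∣≡k) ⟩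
    ∣ A ∣ + ∣ B ∣ + ∣ ∁ A ∩ ∁ B ∣ ≡⟨ ∣p∣+∣q∣+∣∁p∩∁q∣≡n A B A~B ⟩
    N                             ≡⟨ N≡k+[k+t] ⟩
    k + (k + t)                   ≡⟨ sym (+-assoc k k t) ⟩
    k + k + t                     ∎)
    where open ≡-Reasoning

  k≤∣A∩B∣⇒A≡B : (A B : V) → k ≤ ∣ proj₁ A ∩ proj₁ B ∣ → A ≡ B
  k≤∣A∩B∣⇒A≡B (A , ∣A∣≡k) (B , ∣B∣≡k) k≤ = KVertex-≡ (∣p∣≤∣p∩q∣⇒∣q∣≤∣p∩q∣⇒p≡q
    (subst (_≤ ∣ A ∩ B ∣) (sym ∣A∣≡k) k≤) (subst (_≤ ∣ A ∩ B ∣) (sym ∣B∣≡k) k≤))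

  choose-vertex : (U B : Subset N) {i o : ℕ} → i + o ≡ k → i ≤ ∣ U ∩ B ∣ → o ≤ ∣ U ∩ ∁ B ∣ →
                  Σ V λ C → proj₁ C ⊆ U × ∣ proj₁ C ∩ B ∣ ≡ i
  choose-vertex U B i+o≡k i≤ o≤ =
    let C , C⊆U , ∣C∩B∣≡i , ∣C∩∁B∣≡o = choose-⊆ U B i≤ o≤
    in (C , trans (sym (∣p∩q∣+∣p∩∁q∣≡∣p∣ C B)) (trans (cong₂ _+_ ∣C∩B∣≡i ∣C∩∁B∣≡o) i+o≡k)) , C⊆U , ∣C∩B∣≡i

  ∣A∩B∣+∣∁A∩B∣≡k : (A B : V) → ∣ proj₁ A ∩ proj₁ B ∣ + ∣ ∁ (proj₁ A) ∩ proj₁ B ∣ ≡ k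
  ∣A∩B∣+∣∁A∩B∣≡k (A , _) (B , ∣B∣≡k) = trans (∣p∩q∣+∣∁p∩q∣≡∣q∣ A B) ∣B∣≡k

  ∣∁A∩B∣+∣∁A∩∁B∣≡k+t : (A B : V) → ∣ ∁ (proj₁ A) ∩ proj₁ B ∣ + ∣ ∁ (proj₁ A) ∩ ∁ (proj₁ B) ∣ ≡ k + t
  ∣∁A∩B∣+∣∁A∩∁B∣≡k+t A B = trans (∣p∩q∣+∣p∩∁q∣≡∣p∣ (∁ (proj₁ A)) (proj₁ B)) (∣∁A∣≡k+t A)

  adjacent-with-overlap : (C B : V) {i o : ℕ} → i + o ≡ k → ∣ proj₁ C ∩ proj₁ B ∣ ≡ i →
                          Σ V λ A′ → KAdj C A′ × ∣ proj₁ A′ ∩ proj₁ B ∣ ≡ o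
  adjacent-with-overlap C B {i} {o} i+o≡k ∣C∩B∣≡i =
    let A′ , A′⊆∁C , ∣A′∩B∣≡o = choose-vertex (∁ (proj₁ C)) (proj₁ B) (trans (+-comm o i) i+o≡k)
                                  (≤-reflexive (sym x≡o)) (subst (i ≤_) (sym y≡i+t) (m≤m+n i t))
    in A′ , q⊆∁p⇒Empty[p∩q] A′⊆∁C , ∣A′∩B∣≡o
    where
    open ≡-Reasoning
    x = ∣ ∁ (proj₁ C) ∩ proj₁ B ∣
    y = ∣ ∁ (proj₁ C) ∩ ∁ (proj₁ B) ∣
    x≡o : x ≡ o
    x≡o = +-cancelˡ-≡ i x o (begin
      i + x                   ≡⟨ cong (_+ x) (sym ∣C∩B∣≡i) ⟩
      ∣ proj₁ C ∩ proj₁ B ∣ + x ≡⟨ ∣A∩B∣+∣∁A∩B∣≡k C B ⟩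
      k                       ≡⟨ sym i+o≡k ⟩
      i + o                   ∎)
    y≡i+t : y ≡ i + t
    y≡i+t = +-cancelˡ-≡ o y (i + t) (begin
      o + y         ≡⟨ cong (_+ y) (sym x≡o) ⟩
      x + y         ≡⟨ ∣∁A∩B∣+∣∁A∩∁B∣≡k+t C B ⟩
      k + t         ≡⟨ cong (_+ t) (trans (sym i+o≡k) (+-comm i o)) ⟩
      o + i + t     ≡⟨ +-assoc o i t ⟩
      o + (i + t)   ∎)

  exchange : (A B : V) {i o : ℕ} → i + o ≡ k →
             i ≤ ∣ ∁ (proj₁ A) ∩ proj₁ B ∣ → o ≤ ∣ ∁ (proj₁ A) ∩ ∁ (proj₁ B) ∣ →
             Σ V λ C → Σ V λ A′ → KAdj A C × KAdj C A′ × ∣ proj₁ A′ ∩ proj₁ B ∣ ≡ o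
  exchange A B i+o≡k i≤ o≤ =
    let C , C⊆∁A , ∣C∩B∣≡i = choose-vertex (∁ (proj₁ A)) (proj₁ B) i+o≡k i≤ o≤
        A′ , C~A′ , ∣A′∩B∣≡o = adjacent-with-overlap C B i+o≡k ∣C∩B∣≡i
    in C , A′ , q⊆∁p⇒Empty[p∩q] C⊆∁A , C~A′ , ∣A′∩B∣≡o

  approach : (A B : V) → Σ V λ C → Σ V λ A′ → KAdj A C × KAdj C A′ ×
             ∣ proj₁ A′ ∩ proj₁ B ∣ ≡ k ⊓ (∣ proj₁ A ∩ proj₁ B ∣ + t)
  approach A B = exchange A B (m∸n+n≡m (m⊓n≤m k (s + t))) i≤x o≤y
    where
    s = ∣ proj₁ A ∩ proj₁ B ∣
    x = ∣ ∁ (proj₁ A) ∩ proj₁ B ∣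
    y = ∣ ∁ (proj₁ A) ∩ ∁ (proj₁ B) ∣
    s+x≡k : s + x ≡ k
    s+x≡k = ∣A∩B∣+∣∁A∩B∣≡k A B
    y≡s+t : y ≡ s + t
    y≡s+t = +-cancelˡ-≡ x y (s + t) (begin
      x + y         ≡⟨ ∣∁A∩B∣+∣∁A∩∁B∣≡k+t A B ⟩
      k + t         ≡⟨ cong (_+ t) (trans (sym s+x≡k) (+-comm s x)) ⟩
      x + s + t     ≡⟨ +-assoc x s t ⟩
      x + (s + t)   ∎)
      where open ≡-Reasoning
    o≤y : k ⊓ (s + t) ≤ y
    o≤y = subst (k ⊓ (s + t) ≤_) (sym y≡s+t) (m⊓n≤n k (s + t))
    i≤x : k ∸ k ⊓ (s + t) ≤ x
    i≤x = m≤n+o⇒m∸n≤o k (k ⊓ (s + t)) (subst (k ≤_) (sym (+-distribʳ-⊓ x k (s + t)))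
      (⊓-glb (m≤m+n k x) (subst (_≤ s + t + x) s+x≡k (+-monoˡ-≤ x (m≤m+n s t)))))

  even-walk : ∀ j (A B : V) → k ≤ ∣ proj₁ A ∩ proj₁ B ∣ + j * t → ∀ i → Walk (A , i) (B , i) (twice j)
  even-walk zero    A B k≤ i =
    subst (λ B → Walk (A , i) (B , i) 0) (k≤∣A∩B∣⇒A≡B A B (subst (k ≤_) (+-identityʳ _) k≤)) stop
  even-walk (suc j) A B k≤ i =
    let C , A′ , A~C , C~A′ , ∣A′∩B∣≡ = approach A B
        k≤′ = subst (λ a → k ≤ a + j * t) (sym ∣A′∩B∣≡)
                (m≤n+[o+p]⇒m≤m⊓[n+o]+p {n = ∣ proj₁ A ∩ proj₁ B ∣} {o = t} k≤)
    in detour i {A} {C} {A′} A~C C~A′ (even-walk j A′ B k≤′ i)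

  k≤∣A∩B∣+c*t : (A B : V) → k ≤ ∣ proj₁ A ∩ proj₁ B ∣ + c * t
  k≤∣A∩B∣+c*t A B = ≤-trans (m≤⌈m/n⌉*n k t′) (m≤n+m (c * t) _)

  neighbour : (A : V) → Σ V λ C → KAdj A C
  neighbour (A , ∣A∣≡k) =
    let C , C⊆∁A , ∣C∣≡k = choose-⊆-ofSize (∁ A) (subst (k ≤_) (sym (∣∁A∣≡k+t (A , ∣A∣≡k))) (m≤m+n k t))
    in (C , ∣C∣≡k) , q⊆∁p⇒Empty[p∩q] C⊆∁A

  odd-walk : (A B : V) (i : Bool) → Walk (A , i) (B , not i) (2 * c + 1)
  odd-walk A B i =
    let C , A~C = neighbour A
    in subst (Walk (A , i) (B , not i)) (1+twice≡2*+1 c)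
         (step (incident i {A} {C} A~C) (even-walk c C B (k≤∣A∩B∣+c*t C B) (not i)))

  two-step-drift : (R : Subset N) {x y z : Elem N k} → IncEdge x y → IncEdge y z →
                   ∣ R ∩ kset z ∣ ≤ ∣ R ∩ kset x ∣ + t
  two-step-drift R {x} {y} {z} e₁ e₂ = +-cancelʳ-≤ ∣ R ∩ Q ∣ ∣ R ∩ P′ ∣ (∣ R ∩ P ∣ + t) (begin
    ∣ R ∩ P′ ∣ + ∣ R ∩ Q ∣                          ≤⟨ m≤m+n _ ∣ R ∩ ∁ P′ ∩ ∁ Q ∣ ⟩
    ∣ R ∩ P′ ∣ + ∣ R ∩ Q ∣ + ∣ R ∩ ∁ P′ ∩ ∁ Q ∣     ≡⟨ ∣r∩p∣+∣r∩q∣+∣r∩∁p∩∁q∣≡∣r∣ P′ Q R P′~Q ⟩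
    ∣ R ∣                                           ≡⟨ sym (∣r∩p∣+∣r∩q∣+∣r∩∁p∩∁q∣≡∣r∣ P Q R P~Q) ⟩
    ∣ R ∩ P ∣ + ∣ R ∩ Q ∣ + ∣ R ∩ ∁ P ∩ ∁ Q ∣       ≤⟨ +-monoʳ-≤ (∣ R ∩ P ∣ + ∣ R ∩ Q ∣) outside≤t ⟩
    ∣ R ∩ P ∣ + ∣ R ∩ Q ∣ + t                       ≡⟨ xy∙z≈xz∙y (∣ R ∩ P ∣) (∣ R ∩ Q ∣) t ⟩
    ∣ R ∩ P ∣ + t + ∣ R ∩ Q ∣                       ∎)
    where
    open ≤-Reasoning
    P = kset x
    Q = kset y
    P′ = kset z
    P~Q : Empty (P ∩ Q)
    P~Q = incident⇒KAdj e₁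
    P′~Q : Empty (P′ ∩ Q)
    P′~Q = KAdj-sym {A = proj₁ y} {B = proj₁ z} (incident⇒KAdj e₂)
    outside≤t : ∣ R ∩ ∁ P ∩ ∁ Q ∣ ≤ t
    outside≤t = subst (∣ R ∩ ∁ P ∩ ∁ Q ∣ ≤_) (∣∁A∩∁B∣≡t (proj₁ x) (proj₁ y) P~Q) (∣p∩q∣≤∣q∣ R (∁ P ∩ ∁ Q))

  twice-walk-drift : (R : Subset N) {x y : Elem N k} (j : ℕ) → Walk x y (twice j) →
                     ∣ R ∩ kset y ∣ ≤ ∣ R ∩ kset x ∣ + j * t
  twice-walk-drift R         zero    stop = m≤m+n _ 0
  twice-walk-drift R {x} {y} (suc j) (step {y = x₁} e₁ (step {y = x₂} e₂ w)) = begin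
    ∣ R ∩ kset y ∣               ≤⟨ twice-walk-drift R j w ⟩
    ∣ R ∩ kset x₂ ∣ + j * t      ≤⟨ +-monoˡ-≤ (j * t) (two-step-drift R e₁ e₂) ⟩
    ∣ R ∩ kset x ∣ + t + j * t   ≡⟨ +-assoc (∣ R ∩ kset x ∣) t (j * t) ⟩
    ∣ R ∩ kset x ∣ + suc j * t   ∎
    where open ≤-Reasoning

  no-shorter-walk : (A : V) (i : Bool) (m : ℕ) → m < 2 * c + 1 → ¬ Walk (A , i) (A , not i) m
  no-shorter-walk A       i m m<2c+1 w with parity m
  ... | j , inj₁ refl = not-¬ refl (sym (twice-walk-preserves-type j w))
  no-shorter-walk (A , ∣A∣≡k) i _ m<2c+1 (step {y = x₁} e w) | j , inj₂ refl =
    <⇒≱ j<c (m≤o*n⇒⌈m/n⌉≤o t′ j k≤j*t)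
    where
    ∣A∩x₁∣≡0 : ∣ A ∩ kset x₁ ∣ ≡ 0
    ∣A∩x₁∣≡0 = trans (cong ∣_∣ (Empty-unique (incident⇒KAdj e))) (∣⊥∣≡0 N)
    k≤j*t : k ≤ j * t
    k≤j*t = subst₂ (λ a b → a ≤ b + j * t) (trans (cong ∣_∣ (∩-idem A)) ∣A∣≡k) ∣A∩x₁∣≡0
              (twice-walk-drift A j w)
    j<c : j < c
    j<c = *-cancelˡ-< 2 j c (subst₂ _<_ (twice≡2* j) (twice≡2* c)
            (s≤s⁻¹ (subst (suc (twice j) <_) (sym (1+twice≡2*+1 c)) m<2c+1)))

  twice-c≤2*c+1 : twice c ≤ 2 * c + 1
  twice-c≤2*c+1 = ≤-trans (≤-reflexive (twice≡2* c)) (m≤m+n (2 * c) 1)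

  within-2*c+1 : (x y : Elem N k) → DistLe x y (2 * c + 1)
  within-2*c+1 (A , false) (B , false) = twice c , twice-c≤2*c+1 , even-walk c A B (k≤∣A∩B∣+c*t A B) false
  within-2*c+1 (A , true)  (B , true)  = twice c , twice-c≤2*c+1 , even-walk c A B (k≤∣A∩B∣+c*t A B) true
  within-2*c+1 (A , false) (B , true)  = 2 * c + 1 , ≤-refl , odd-walk A B false
  within-2*c+1 (A , true)  (B , false) = 2 * c + 1 , ≤-refl , odd-walk A B true

  some-vertex : V
  some-vertex =
    let A , _ , ∣A∣≡k = choose-⊆-ofSize (⊤ {N}) (subst (k ≤_) (sym (trans (∣⊤∣≡n N) N≡k+[k+t])) (m≤m+n k (k + t)))
    in A , ∣A∣≡k

  diameter : (i : Bool) → IDiameter N k i (2 * c + 1)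
  diameter i = (λ x y _ → within-2*c+1 x y) ,
               (some-vertex , i) , (some-vertex , not i) , refl , odd-walk some-vertex some-vertex i ,
               no-shorter-walk some-vertex i

lemma3p1 : (n k : ℕ) → 1 ≤ k → 2 * k + 1 ≤ n →
    IDiameter n k false (2 * ceilDiv k (n ∸ 2 * k) + 1)
    × IDiameter n k true (2 * ceilDiv k (n ∸ 2 * k) + 1)
lemma3p1 n k _ 2k+1≤n with n ∸ 2 * k in n∸2k≡t
... | zero   = ⊥-elim (m+1+n≰m (2 * k) (≤-trans 2k+1≤n (m∸n≡0⇒m≤n n∸2k≡t)))
... | suc t′ = subst (λ N → IDiameter N k false D × IDiameter N k true D) 2k+t≡n (diameter false , diameter true)
  where
  open KneserGeometry k t′
  D = 2 * c + 1
  2k+t≡n : 2 * k + suc t′ ≡ n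
  2k+t≡n = trans (cong (2 * k +_) (sym n∸2k≡t)) (m+[n∸m]≡n (≤-trans (m≤m+n (2 * k) 1) 2k+1≤n))
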